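{- Let $\Lambda$ be a connected $k$-graph, let $u\in\Lambda^0$, and let $\alpha$ be an action of $\mathbb{Z}^l$ on $\Lambda$ by automorphisms. Then there is an extension of groups \[ 1\to\pi_1(\Lambda,u)\xrightarrow{(i_\Lambda)_*}\pi_1\big(\Lambda\times_\alpha\mathbb{Z}^l,(u,0)\big)\to\mathbb{Z}^l\to0, \] where $i_\Lambda:\Lambda\to\Lambda\times_\alpha\mathbb{Z}^l$, $\lambda\mapsto(\lambda,0)$, is the canonical embedding.
   Context: \textbf{$k$-graphs.} A $k$-graph is a countable small category $\Lambda$ with a functor $d:\Lambda\to\mathbb{N}^k$ satisfying the unique factorization property: whenever $d(\lambda)=m+n$, there are unique $\mu,\nu$ with $d(\mu)=m$, $d(\nu)=n$ and $\lambda=\mu\nu$. $\mathcal{G}(\Lambda)$ denotes the fundamental groupoid (the groupoid with a functor from $\Lambda$ that is universal among functors from $\Lambda$ to groupoids), and $\pi_1(\Lambda,u)=u\mathcal{G}(\Lambda)u$. $\Lambda$ is connected if $\mathcal{G}(\Lambda)$ is connected. A functor between graphs induces a homomorphism of fundamental groups. \textbf{Crossed product.} The crossed-product $(k+l)$-graph $\Lambda\times_\alpha\mathbb{Z}^l$ is $\Lambda\times\mathbb{N}^l$ with degree $d(\lambda,m)=(d(\lambda),m)$, $r(\lambda,m)=(r(\lambda),0)$, $s(\lambda,m)=(\alpha_{ -m}(s(\lambda)),0)$ and $(\lambda,m)(\mu,n)=(\lambda\alpha_m(\mu),m+n)$. -}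

module Defs where

open import Data.Nat using (ℕ; zero; suc) renaming (_+_ to _+ℕ_)
open import Data.Integer using (ℤ; +_; -_) renaming (_+_ to _+ℤ_)
open import Data.Integer.Properties using (pos-+; neg-distrib-+; +-assoc; +-comm; +-inverseˡ; +-inverseʳ; +-identityʳ)
open import Data.Vec using (Vec; []; _∷_; map; zipWith; replicate)
open import Data.Product using (Σ; Σ-syntax; _×_; _,_; proj₁)
open import Function.Definitions using (Injective)
open import Function.Bundles using (_⇔_)
open import Relation.Binary.PropositionalEquality using (_≡_; refl; sym; trans; cong; cong₂; subst)

_⊕_ : ∀ {k} → Vec ℕ k → Vec ℕ k → Vec ℕ k
_⊕_ = zipWith _+ℕ_

0ᴺ : ∀ k → Vec ℕ k
0ᴺ k = replicate k 0

_+ᶻ_ : ∀ {l} → Vec ℤ l → Vec ℤ l → Vec ℤ l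
_+ᶻ_ = zipWith _+ℤ_

negᶻ : ∀ {l} → Vec ℤ l → Vec ℤ l
negᶻ = map -_

0ᶻ : ∀ l → Vec ℤ l
0ᶻ l = replicate l (+ 0)

ι : ∀ {l} → Vec ℕ l → Vec ℤ l
ι = map +_

-- Underlying category data (objects, morphisms, identities, composition).
-- Hom x y = morphisms with range x and source y; f · g = "f after g".

record CatData : Set₁ where
  infixl 7 _·_
  field
    Obj : Set
    Hom : Obj → Obj → Set
    idm : ∀ x → Hom x x
    _·_ : ∀ {x y z} → Hom x y → Hom y z → Hom x z

Mor : (C : CatData) → Set
Mor C = Σ[ x ∈ CatData.Obj C ] Σ[ y ∈ CatData.Obj C ] CatData.Hom C x y

record KGraph (k : ℕ) : Set₁ where
  field
    cat : CatData
  open CatData cat public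
  field
    idˡ : ∀ {x y} (f : Hom x y) → idm x · f ≡ f
    idʳ : ∀ {x y} (f : Hom x y) → f · idm y ≡ f
    assoc : ∀ {w x y z} (f : Hom w x) (g : Hom x y) (h : Hom y z) →
            (f · g) · h ≡ f · (g · h)
    countObj : Σ[ c ∈ (Obj → ℕ) ] Injective _≡_ _≡_ c
    countMor : Σ[ c ∈ (Mor cat → ℕ) ] Injective _≡_ _≡_ c
    d : ∀ {x y} → Hom x y → Vec ℕ k
    d-id : ∀ x → d (idm x) ≡ 0ᴺ k
    d-· : ∀ {x y z} (f : Hom x y) (g : Hom y z) → d (f · g) ≡ d f ⊕ d g
    factor : ∀ {x z} (λ' : Hom x z) (m n : Vec ℕ k) → d λ' ≡ m ⊕ n →
             Σ[ c ∈ Obj ] Σ[ μ ∈ Hom x c ] Σ[ ν ∈ Hom c z ]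
               (d μ ≡ m × d ν ≡ n × μ · ν ≡ λ')
    factor-unique : ∀ {x z} (λ' : Hom x z) (m n : Vec ℕ k) →
             (c c' : Obj) (μ : Hom x c) (ν : Hom c z) (μ' : Hom x c') (ν' : Hom c' z) →
             d μ ≡ m → d ν ≡ n → μ · ν ≡ λ' →
             d μ' ≡ m → d ν' ≡ n → μ' · ν' ≡ λ' →
             _≡_ {A = Σ[ a ∈ Obj ] (Hom x a × Hom a z)} (c , μ , ν) (c' , μ' , ν')

-- Actions of ℤ^l on a k-graph by automorphisms
-- (a homomorphism ℤ^l → Aut Λ: each α_m is a degree-preserving functor,
--  α_0 = id and α_m ∘ α_n = α_{m+n}; bijectivity follows).

record Action {k : ℕ} (Λ : KGraph k) (l : ℕ) : Set where
  open KGraph Λ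
  field
    αo : Vec ℤ l → Obj → Obj
    αh : (m : Vec ℤ l) → ∀ {x y} → Hom x y → Hom (αo m x) (αo m y)
    αh-id : ∀ m x → αh m (idm x) ≡ idm (αo m x)
    αh-· : ∀ m {x y z} (f : Hom x y) (g : Hom y z) → αh m (f · g) ≡ αh m f · αh m g
    αh-d : ∀ m {x y} (f : Hom x y) → d (αh m f) ≡ d f
    α0-o : ∀ x → αo (0ᶻ l) x ≡ x
    α0-h : ∀ {x y} (f : Hom x y) →
           _≡_ {A = Mor cat} (αo (0ᶻ l) x , αo (0ᶻ l) y , αh (0ᶻ l) f) (x , y , f)
    α+-o : ∀ m n x → αo m (αo n x) ≡ αo (m +ᶻ n) x
    α+-h : ∀ m n {x y} (f : Hom x y) →
           _≡_ {A = Mor cat} (αo m (αo n x) , αo m (αo n y) , αh m (αh n f))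
                             (αo (m +ᶻ n) x , αo (m +ᶻ n) y , αh (m +ᶻ n) f)

neg-ι-0 : ∀ l → negᶻ (ι (0ᴺ l)) ≡ 0ᶻ l
neg-ι-0 zero = refl
neg-ι-0 (suc l) = cong (+ 0 ∷_) (neg-ι-0 l)

+ᶻ-neg : ∀ {l} (m : Vec ℤ l) → m +ᶻ negᶻ m ≡ 0ᶻ l
+ᶻ-neg [] = refl
+ᶻ-neg (a ∷ m) = cong₂ _∷_ (+-inverseʳ a) (+ᶻ-neg m)

private
  lem : ∀ (a b : ℕ) → (- (+ (a +ℕ b))) +ℤ (+ a) ≡ - (+ b)
  lem a b = trans (cong (λ t → (- t) +ℤ (+ a)) (pos-+ a b))
           (trans (cong (_+ℤ (+ a)) (neg-distrib-+ (+ a) (+ b)))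
           (trans (+-assoc (- (+ a)) (- (+ b)) (+ a))
           (trans (cong ((- (+ a)) +ℤ_) (+-comm (- (+ b)) (+ a)))
           (trans (sym (+-assoc (- (+ a)) (+ a) (- (+ b))))
           (trans (cong (_+ℤ (- (+ b))) (+-inverseˡ (+ a)))
                  (Data.Integer.Properties.+-identityˡ (- (+ b))))))))

neg-ι-⊕ : ∀ {l} (a b : Vec ℕ l) → negᶻ (ι (a ⊕ b)) +ᶻ ι a ≡ negᶻ (ι b)
neg-ι-⊕ [] [] = refl
neg-ι-⊕ (x ∷ a) (y ∷ b) = cong₂ _∷_ (lem x y) (neg-ι-⊕ a b)

-- Morphisms are pairs (λ, m) ∈ Λ × ℕ^l with r(λ, m) = r(λ) and
-- s(λ, m) = α_{-m}(s(λ)); composition (λ,m)(μ,n) = (λ α_m(μ), m+n).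
-- Vertices (v, 0) are identified with v ∈ Λ^0.

module Crossed {k l : ℕ} (Λ : KGraph k) (α : Action Λ l) where
  open KGraph Λ
  open Action α

  HomX : Obj → Obj → Set
  HomX x y = Σ[ m ∈ Vec ℕ l ] Σ[ z ∈ Obj ] (Hom x z × αo (negᶻ (ι m)) z ≡ y)

  private
    back : ∀ (m : Vec ℤ l) z y → αo (negᶻ m) z ≡ y → αo m y ≡ z
    back m z y p = trans (cong (αo m) (sym p))
                   (trans (α+-o m (negᶻ m) z)
                   (trans (cong (λ v → αo v z) (+ᶻ-neg m)) (α0-o z)))

    srcX : ∀ (m n : Vec ℕ l) w y' → αo (negᶻ (ι n)) w ≡ y' →
           αo (negᶻ (ι (m ⊕ n))) (αo (ι m) w) ≡ y'
    srcX m n w y' q = trans (α+-o (negᶻ (ι (m ⊕ n))) (ι m) w)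
                      (trans (cong (λ v → αo v w) (neg-ι-⊕ m n)) q)

  idX : ∀ x → HomX x x
  idX x = 0ᴺ l , x , idm x , trans (cong (λ v → αo v x) (neg-ι-0 l)) (α0-o x)

  compX : ∀ {x y y'} → HomX x y → HomX y y' → HomX x y'
  compX {x} {y} {y'} (m , z , λ' , p) (n , w , μ , q) =
    m ⊕ n , αo (ι m) w ,
    λ' · subst (λ t → Hom t (αo (ι m) w)) (back (ι m) z y p) (αh (ι m) μ) ,
    srcX m n w y' q

  crossedCat : CatData
  crossedCat = record { Obj = Obj ; Hom = HomX ; idm = idX ; _·_ = compX }

  incl : ∀ {x y} → Hom x y → HomX x y
  incl {x} {y} f = 0ᴺ l , y , f , trans (cong (λ v → αo v y) (neg-ι-0 l)) (α0-o y)

-- Fundamental groupoid G(C) of a category C, presented as the free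
-- groupoid on C modulo the relations of C: arrows x ← y of G(C) are
-- formal zig-zag words up to the congruence _≈_ below.

module Groupoid (C : CatData) where
  open CatData C

  infixr 5 _∷⁺_ _∷⁻_ _++_
  data Word : Obj → Obj → Set where
    []   : ∀ {x} → Word x x
    _∷⁺_ : ∀ {x z y} → Hom x z → Word z y → Word x y
    _∷⁻_ : ∀ {x z y} → Hom z x → Word z y → Word x y   -- f⁻¹ · w

  infix 4 _≈_
  data _≈_ : ∀ {x y} → Word x y → Word x y → Set where
    ≈-refl  : ∀ {x y} {w : Word x y} → w ≈ w
    ≈-sym   : ∀ {x y} {v w : Word x y} → v ≈ w → w ≈ v
    ≈-trans : ∀ {x y} {u v w : Word x y} → u ≈ v → v ≈ w → u ≈ w
    cong⁺   : ∀ {x z y} (f : Hom x z) {v w : Word z y} → v ≈ w → f ∷⁺ v ≈ f ∷⁺ w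
    cong⁻   : ∀ {x z y} (f : Hom z x) {v w : Word z y} → v ≈ w → f ∷⁻ v ≈ f ∷⁻ w
    comp    : ∀ {x z z' y} (f : Hom x z) (g : Hom z z') (w : Word z' y) →
              f ∷⁺ g ∷⁺ w ≈ (f · g) ∷⁺ w
    unit    : ∀ {x y} (w : Word x y) → idm x ∷⁺ w ≈ w
    invʳ    : ∀ {x z y} (f : Hom x z) (w : Word x y) → f ∷⁺ f ∷⁻ w ≈ w
    invˡ    : ∀ {x z y} (f : Hom z x) (w : Word x y) → f ∷⁻ f ∷⁺ w ≈ w

  _++_ : ∀ {x y z} → Word x y → Word y z → Word x z
  [] ++ w = w
  (f ∷⁺ v) ++ w = f ∷⁺ (v ++ w)
  (f ∷⁻ v) ++ w = f ∷⁻ (v ++ w)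

  -- π₁(C, u) = u G(C) u: its elements are Word u u up to _≈_,
  -- with multiplication _++_ (unit [], inverses by reversing words).
  π₁ : Obj → Set
  π₁ u = Word u u

  Connected : Set
  Connected = ∀ x y → Word x y

mapWord : (C D : CatData) (F₀ : CatData.Obj C → CatData.Obj D)
          (F₁ : ∀ {x y} → CatData.Hom C x y → CatData.Hom D (F₀ x) (F₀ y)) →
          ∀ {x y} → Groupoid.Word C x y → Groupoid.Word D (F₀ x) (F₀ y)
mapWord C D F₀ F₁ Groupoid.[] = Groupoid.[]
mapWord C D F₀ F₁ (f Groupoid.∷⁺ w) = F₁ f Groupoid.∷⁺ mapWord C D F₀ F₁ w
mapWord C D F₀ F₁ (f Groupoid.∷⁻ w) = F₁ f Groupoid.∷⁻ mapWord C D F₀ F₁ w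

module _ {k l : ℕ} (Λ : KGraph k) (α : Action Λ l) where
  open Crossed Λ α

  i* : ∀ {x y} → Groupoid.Word (KGraph.cat Λ) x y → Groupoid.Word crossedCat x y
  i* = mapWord (KGraph.cat Λ) crossedCat (λ x → x) incl

-- "1 → G --i--> H --q--> ℤ^l → 0 is an extension of groups", where
-- G = π₁(C,u) and H = π₁(D,v) are presented as words modulo ≈ with
-- multiplication ++, i is a given map on words and q is a map to ℤ^l:
-- i and q are well-defined homomorphisms, i is injective, q is
-- surjective, and ker q = im i.
IsExtension : (C D : CatData) (u : CatData.Obj C) (v : CatData.Obj D) (l : ℕ)
              (i : Groupoid.Word C u u → Groupoid.Word D v v)
              (q : Groupoid.Word D v v → Vec ℤ l) → Set
IsExtension C D u v l i q =
    (∀ {a b : Word C u u} → _≈C_ a b → _≈D_ (i a) (i b))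
  × (∀ (a b : Word C u u) → _≈D_ (i (a ++C b)) (i a ++D i b))
  × (∀ {a b : Word D v v} → _≈D_ a b → q a ≡ q b)
  × (∀ (a b : Word D v v) → q (a ++D b) ≡ q a +ᶻ q b)
  × (∀ (a b : Word C u u) → _≈D_ (i a) (i b) → _≈C_ a b)
  × (∀ (b : Word D v v) → (q b ≡ 0ᶻ l) ⇔ (Σ[ a ∈ Word C u u ] _≈D_ (i a) b))
  × (∀ (z : Vec ℤ l) → Σ[ b ∈ Word D v v ] q b ≡ z)
  where
    open Groupoid using (Word)
    _≈C_ = Groupoid._≈_ C
    _≈D_ = Groupoid._≈_ D
    _++C_ = Groupoid._++_ C
    _++D_ = Groupoid._++_ D

module Submission where

-- Let D = Λ ×_α ℤ^l.  The map q of the extension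
-- is deg : Word D → ℤ^l, the signed sum of the ℕ^l-components of the
-- letters of a word.
--   * deg respects ≈ and concatenation and vanishes on the image of i_*.
--   * deg is onto when Λ is connected: ι P − ι N is the degree of the loop
--     shift_P · (a path in Λ) · shift_N⁻¹, where shift_m is an identity of
--     Λ regarded as the morphism (id, m) of D.
--   * i_* is injective: "unwinding" a word of D (reading a letter (λ, m) as
--     α_a(λ), with the index a advanced by the degrees already read) respects
--     ≈ and recovers c from i_*(c).
--   * ker deg ⊆ im i_*: using shift_n · (λ, 0) = (α_n λ, 0) · shift_n, every
--     word is ≈ to a normal form shift_n⁻¹ · shift_p · i_*(c); if its degree
--     p − n vanishes the two shifts cancel.

open import Defs
open import Data.Nat using (ℕ; suc)
open import Data.Integer using (ℤ; +_; -_; -[1+_])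
import Data.Integer.Properties as ℤP
import Data.Nat.Properties as ℕP
open import Data.Vec using (Vec; []; _∷_; map; zipWith)
open import Data.Vec.Properties
  using (∷-injectiveˡ; ∷-injectiveʳ; map-replicate; zipWith-assoc; zipWith-comm;
         zipWith-identityˡ; zipWith-identityʳ; zipWith-inverseˡ)
open import Data.Product using (Σ; Σ-syntax; _,_; proj₁; proj₂)
open import Function.Bundles using (mk⇔)
open import Relation.Binary.Bundles using (Setoid)
import Relation.Binary.Reasoning.Setoid as SetoidReasoning
open import Relation.Binary.PropositionalEquality
  using (_≡_; refl; sym; trans; cong; cong₂; subst; module ≡-Reasoning)
open import Axiom.UniquenessOfIdentityProofs.WithK using (uip)

map-zipWith-homo : ∀ {A B : Set} {n} (f : A → B) {_∙_ : A → A → A} {_∘_ : B → B → B} →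
                   (∀ x y → f (x ∙ y) ≡ f x ∘ f y) →
                   (xs ys : Vec A n) → map f (zipWith _∙_ xs ys) ≡ zipWith _∘_ (map f xs) (map f ys)
map-zipWith-homo f hom []       []       = refl
map-zipWith-homo f hom (x ∷ xs) (y ∷ ys) = cong₂ _∷_ (hom x y) (map-zipWith-homo f hom xs ys)

map-injective : ∀ {A B : Set} {n} {f : A → B} → (∀ {x y} → f x ≡ f y → x ≡ y) →
                ∀ {xs ys : Vec A n} → map f xs ≡ map f ys → xs ≡ ys
map-injective inj {[]}     {[]}     _ = refl
map-injective inj {x ∷ xs} {y ∷ ys} e = cong₂ _∷_ (inj (∷-injectiveˡ e)) (map-injective inj (∷-injectiveʳ e))

+ᶻ-assoc : ∀ {l} (a b c : Vec ℤ l) → (a +ᶻ b) +ᶻ c ≡ a +ᶻ (b +ᶻ c)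
+ᶻ-assoc = zipWith-assoc ℤP.+-assoc

+ᶻ-comm : ∀ {l} (a b : Vec ℤ l) → a +ᶻ b ≡ b +ᶻ a
+ᶻ-comm = zipWith-comm ℤP.+-comm

+ᶻ-identityˡ : ∀ {l} (a : Vec ℤ l) → 0ᶻ l +ᶻ a ≡ a
+ᶻ-identityˡ = zipWith-identityˡ ℤP.+-identityˡ

+ᶻ-identityʳ : ∀ {l} (a : Vec ℤ l) → a +ᶻ 0ᶻ l ≡ a
+ᶻ-identityʳ = zipWith-identityʳ ℤP.+-identityʳ

+ᶻ-inverseˡ : ∀ {l} (a : Vec ℤ l) → negᶻ a +ᶻ a ≡ 0ᶻ l
+ᶻ-inverseˡ = zipWith-inverseˡ ℤP.+-inverseˡ

negᶻ-distrib : ∀ {l} (a b : Vec ℤ l) → negᶻ (a +ᶻ b) ≡ negᶻ a +ᶻ negᶻ b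
negᶻ-distrib = map-zipWith-homo -_ ℤP.neg-distrib-+

module _ {l : ℕ} where
  open ≡-Reasoning

  +ᶻ-cancel-+- : (a v : Vec ℤ l) → (a +ᶻ v) +ᶻ negᶻ v ≡ a
  +ᶻ-cancel-+- a v = begin
    (a +ᶻ v) +ᶻ negᶻ v  ≡⟨ +ᶻ-assoc a v (negᶻ v) ⟩
    a +ᶻ (v +ᶻ negᶻ v)  ≡⟨ cong (a +ᶻ_) (+ᶻ-neg v) ⟩
    a +ᶻ 0ᶻ l           ≡⟨ +ᶻ-identityʳ a ⟩
    a                   ∎

  +ᶻ-cancel-−+ : (a v : Vec ℤ l) → (a +ᶻ negᶻ v) +ᶻ v ≡ a
  +ᶻ-cancel-−+ a v = begin
    (a +ᶻ negᶻ v) +ᶻ v  ≡⟨ +ᶻ-assoc a (negᶻ v) v ⟩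
    a +ᶻ (negᶻ v +ᶻ v)  ≡⟨ cong (a +ᶻ_) (+ᶻ-inverseˡ v) ⟩
    a +ᶻ 0ᶻ l           ≡⟨ +ᶻ-identityʳ a ⟩
    a                   ∎

  +ᶻ-cancel-+−ˡ : (v w : Vec ℤ l) → v +ᶻ (negᶻ v +ᶻ w) ≡ w
  +ᶻ-cancel-+−ˡ v w = begin
    v +ᶻ (negᶻ v +ᶻ w)  ≡⟨ sym (+ᶻ-assoc v (negᶻ v) w) ⟩
    (v +ᶻ negᶻ v) +ᶻ w  ≡⟨ cong (_+ᶻ w) (+ᶻ-neg v) ⟩
    0ᶻ l +ᶻ w           ≡⟨ +ᶻ-identityˡ w ⟩
    w                   ∎

  +ᶻ-cancel-−+ˡ : (v w : Vec ℤ l) → negᶻ v +ᶻ (v +ᶻ w) ≡ w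
  +ᶻ-cancel-−+ˡ v w = begin
    negᶻ v +ᶻ (v +ᶻ w)  ≡⟨ sym (+ᶻ-assoc (negᶻ v) v w) ⟩
    (negᶻ v +ᶻ v) +ᶻ w  ≡⟨ cong (_+ᶻ w) (+ᶻ-inverseˡ v) ⟩
    0ᶻ l +ᶻ w           ≡⟨ +ᶻ-identityˡ w ⟩
    w                   ∎

  +ᶻ-inverse-unique : (a b : Vec ℤ l) → negᶻ a +ᶻ b ≡ 0ᶻ l → b ≡ a
  +ᶻ-inverse-unique a b e = begin
    b                   ≡⟨ sym (+ᶻ-cancel-+−ˡ a b) ⟩
    a +ᶻ (negᶻ a +ᶻ b)  ≡⟨ cong (a +ᶻ_) e ⟩
    a +ᶻ 0ᶻ l           ≡⟨ +ᶻ-identityʳ a ⟩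
    a                   ∎

⊕-comm : ∀ {l} (m n : Vec ℕ l) → m ⊕ n ≡ n ⊕ m
⊕-comm = zipWith-comm ℕP.+-comm

⊕-identityˡ : ∀ {l} (m : Vec ℕ l) → 0ᴺ l ⊕ m ≡ m
⊕-identityˡ = zipWith-identityˡ ℕP.+-identityˡ

⊕-identityʳ : ∀ {l} (m : Vec ℕ l) → m ⊕ 0ᴺ l ≡ m
⊕-identityʳ = zipWith-identityʳ ℕP.+-identityʳ

ι-0 : ∀ l → ι (0ᴺ l) ≡ 0ᶻ l
ι-0 l = map-replicate +_ 0 l

ι-⊕ : ∀ {l} (m n : Vec ℕ l) → ι (m ⊕ n) ≡ ι m +ᶻ ι n
ι-⊕ = map-zipWith-homo +_ ℤP.pos-+

ι-injective : ∀ {l} {m n : Vec ℕ l} → ι m ≡ ι n → m ≡ n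
ι-injective = map-injective ℤP.+-injective

ℤ^-difference : ∀ {l} (z : Vec ℤ l) → Σ[ P ∈ Vec ℕ l ] Σ[ N ∈ Vec ℕ l ] (ι P +ᶻ negᶻ (ι N) ≡ z)
ℤ^-difference [] = [] , [] , refl
ℤ^-difference (+ n ∷ z) with ℤ^-difference z
... | P , N , e = n ∷ P , 0 ∷ N , cong₂ _∷_ (ℤP.+-identityʳ (+ n)) e
ℤ^-difference (-[1+ n ] ∷ z) with ℤ^-difference z
... | P , N , e = 0 ∷ P , suc n ∷ N , cong (-[1+ n ] ∷_) e

module WordCalculus (C : CatData) where
  open CatData C
  open Groupoid C

  ≡⇒≈ : ∀ {x y} {v w : Word x y} → v ≡ w → v ≈ w
  ≡⇒≈ refl = ≈-refl

  wordSetoid : Obj → Obj → Setoid _ _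
  wordSetoid x y = record
    { Carrier = Word x y ; _≈_ = _≈_
    ; isEquivalence = record { refl = ≈-refl ; sym = ≈-sym ; trans = ≈-trans } }

  module ≈-Reasoning {x y : Obj} = SetoidReasoning (wordSetoid x y)

  inverse-· : ∀ {a b c y} {A : Hom a b} {B : Hom b c} (r : Word a y) →
              B ∷⁻ A ∷⁻ r ≈ (A · B) ∷⁻ r
  inverse-· {A = A} {B} r =
    ≈-trans (≈-sym (invˡ (A · B) (B ∷⁻ A ∷⁻ r)))
      (cong⁻ (A · B) (≈-trans (≈-sym (comp A B (B ∷⁻ A ∷⁻ r)))
                     (≈-trans (cong⁺ A (invʳ B (A ∷⁻ r))) (invʳ A r))))

  split⁺ : ∀ {a b c y} {L : Hom a c} {A : Hom a b} {B : Hom b c} (r : Word c y) →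
           L ≡ A · B → L ∷⁺ r ≈ A ∷⁺ B ∷⁺ r
  split⁺ r refl = ≈-sym (comp _ _ r)

  split⁻ : ∀ {a b c y} {L : Hom a c} {A : Hom a b} {B : Hom b c} (r : Word a y) →
           L ≡ A · B → L ∷⁻ r ≈ B ∷⁻ A ∷⁻ r
  split⁻ r refl = ≈-sym (inverse-· r)

  square⁺ : ∀ {a b b' c y} {A : Hom a b} {B : Hom b c} {A' : Hom a b'} {B' : Hom b' c}
            (r : Word c y) → A · B ≡ A' · B' → A ∷⁺ B ∷⁺ r ≈ A' ∷⁺ B' ∷⁺ r
  square⁺ {A = A} {B} {A'} {B'} r e =
    ≈-trans (comp A B r) (≈-trans (≡⇒≈ (cong (_∷⁺ r) e)) (≈-sym (comp A' B' r)))

  square⁻ : ∀ {a b b' c y} {A : Hom a b} {B : Hom b c} {A' : Hom a b'} {B' : Hom b' c}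
            (r : Word a y) → A · B ≡ A' · B' → B ∷⁻ A ∷⁻ r ≈ B' ∷⁻ A' ∷⁻ r
  square⁻ r e = ≈-trans (inverse-· r) (≈-trans (≡⇒≈ (cong (_∷⁻ r) e)) (≈-sym (inverse-· r)))

  square-turnʳ : ∀ {a b b' c y} {A : Hom a b} {B : Hom b c} {A' : Hom a b'} {B' : Hom b' c}
                 (r : Word b' y) → A · B ≡ A' · B' → B ∷⁺ B' ∷⁻ r ≈ A ∷⁻ A' ∷⁺ r
  square-turnʳ {A = A} {B} {A'} {B'} r e =
    ≈-trans (≈-sym (invˡ A (B ∷⁺ B' ∷⁻ r)))
      (cong⁻ A (≈-trans (comp A B (B' ∷⁻ r))
               (≈-trans (≡⇒≈ (cong (_∷⁺ (B' ∷⁻ r)) e))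
               (≈-trans (≈-sym (comp A' B' (B' ∷⁻ r)))
                        (cong⁺ A' (invʳ B' r))))))

  square-turnˡ : ∀ {a b b' c y} {A : Hom a b} {B : Hom b c} {A' : Hom a b'} {B' : Hom b' c}
                 (r : Word b y) → A · B ≡ A' · B' → A' ∷⁻ A ∷⁺ r ≈ B' ∷⁺ B ∷⁻ r
  square-turnˡ {A = A} {B} {A'} {B'} r e =
    ≈-trans (cong⁻ A' (cong⁺ A (≈-sym (invʳ B r))))
    (≈-trans (cong⁻ A' (comp A B (B ∷⁻ r)))
    (≈-trans (≡⇒≈ (cong (λ h → A' ∷⁻ h ∷⁺ B ∷⁻ r) e))
    (≈-trans (cong⁻ A' (≈-sym (comp A' B' (B ∷⁻ r))))
             (invˡ A' (B' ∷⁺ B ∷⁻ r)))))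

  castW : ∀ {x x' y y'} → x ≡ x' → y ≡ y' → Word x y → Word x' y'
  castW refl refl w = w

  -- Needed because the retraction of the injectivity proof
  -- produces words whose endpoints are only propositionally determined.
  infix 4 _≅_
  data _≅_ {x y} (v : Word x y) : ∀ {x' y'} → Word x' y' → Set where
    ≈⇒≅ : ∀ {w : Word x y} → v ≈ w → v ≅ w

  ≅⇒≈ : ∀ {x y} {v w : Word x y} → v ≅ w → v ≈ w
  ≅⇒≈ (≈⇒≅ r) = r

  ≅-refl : ∀ {x y} {v : Word x y} → v ≅ v
  ≅-refl = ≈⇒≅ ≈-refl

  ≅-sym : ∀ {x y x' y'} {v : Word x y} {w : Word x' y'} → v ≅ w → w ≅ v
  ≅-sym (≈⇒≅ r) = ≈⇒≅ (≈-sym r)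

  ≅-trans : ∀ {x y x' y' x'' y''} {u : Word x y} {v : Word x' y'} {w : Word x'' y''} →
            u ≅ v → v ≅ w → u ≅ w
  ≅-trans (≈⇒≅ r) (≈⇒≅ s) = ≈⇒≅ (≈-trans r s)

  cast-≅ : ∀ {x x' y y'} (e₁ : x ≡ x') (e₂ : y ≡ y') (v : Word x y) → castW e₁ e₂ v ≅ v
  cast-≅ refl refl v = ≅-refl

  ≅-index : ∀ {I : Set} {s t : I → Obj} (F : ∀ i → Word (s i) (t i)) {i j : I} →
            i ≡ j → F i ≅ F j
  ≅-index F refl = ≅-refl

  ≅-cons⁺ : ∀ {x z y x' z' y'} {f : Hom x z} {f' : Hom x' z'} {v : Word z y} {v' : Word z' y'} →
            _≡_ {A = Mor C} (x , z , f) (x' , z' , f') → v ≅ v' → f ∷⁺ v ≅ f' ∷⁺ v'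
  ≅-cons⁺ refl (≈⇒≅ r) = ≈⇒≅ (cong⁺ _ r)

  ≅-cons⁻ : ∀ {x z y x' z' y'} {f : Hom z x} {f' : Hom z' x'} {v : Word z y} {v' : Word z' y'} →
            _≡_ {A = Mor C} (z , x , f) (z' , x' , f') → v ≅ v' → f ∷⁻ v ≅ f' ∷⁻ v'
  ≅-cons⁻ refl (≈⇒≅ r) = ≈⇒≅ (cong⁻ _ r)

  ≅-invʳ : ∀ {x z y₁ x' z' y₂} {f : Hom x z} {u : Word z y₁} {f' : Hom x' z'} {v : Word x' y₂} →
           _≡_ {A = Mor C} (x , z , f) (x' , z' , f') → u ≅ f' ∷⁻ v → f ∷⁺ u ≅ v
  ≅-invʳ refl (≈⇒≅ r) = ≈⇒≅ (≈-trans (cong⁺ _ r) (invʳ _ _))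

  ≅-invˡ : ∀ {x z y₁ x' z' y₂} {f : Hom z x} {u : Word z y₁} {f' : Hom z' x'} {v : Word x' y₂} →
           _≡_ {A = Mor C} (z , x , f) (z' , x' , f') → u ≅ f' ∷⁺ v → f ∷⁻ u ≅ v
  ≅-invˡ refl (≈⇒≅ r) = ≈⇒≅ (≈-trans (cong⁻ _ r) (invˡ _ _))

module Extension {k l : ℕ} (Λ : KGraph k) (α : Action Λ l) where
  open KGraph Λ
  open Action α
  open Crossed Λ α
  open Groupoid using ([]; _∷⁺_; _∷⁻_; ≈-refl; ≈-sym; ≈-trans; cong⁺; cong⁻; comp; unit; invʳ; invˡ)
  module WΛ = WordCalculus cat
  module WD = WordCalculus crossedCat
  open WΛ using (≈⇒≅; _≅_; ≅-refl; ≅-sym; ≅-trans; ≅-index; cast-≅; castW;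
                 ≅-cons⁺; ≅-cons⁻; ≅-invʳ; ≅-invˡ)

  WordΛ WordD : Obj → Obj → Set
  WordΛ = Groupoid.Word cat
  WordD = Groupoid.Word crossedCat

  _≈Λ_ : ∀ {x y} → WordΛ x y → WordΛ x y → Set
  _≈Λ_ = Groupoid._≈_ cat
  _≈D_ : ∀ {x y} → WordD x y → WordD x y → Set
  _≈D_ = Groupoid._≈_ crossedCat

  _++D_ : ∀ {x y z} → WordD x y → WordD y z → WordD x z
  _++D_ = Groupoid._++_ crossedCat

  αo-cong : ∀ {v w : Vec ℤ l} x → v ≡ w → αo v x ≡ αo w x
  αo-cong x = cong (λ v → αo v x)

  α-cancelˡ : ∀ (v : Vec ℤ l) x → αo (negᶻ v) (αo v x) ≡ x
  α-cancelˡ v x = trans (α+-o (negᶻ v) v x) (trans (αo-cong x (+ᶻ-inverseˡ v)) (α0-o x))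

  α-cancelʳ : ∀ (v : Vec ℤ l) x → αo v (αo (negᶻ v) x) ≡ x
  α-cancelʳ v x = trans (α+-o v (negᶻ v) x) (trans (αo-cong x (+ᶻ-neg v)) (α0-o x))

  α-transpose : ∀ {v a b} → αo (negᶻ v) a ≡ b → αo v b ≡ a
  α-transpose {v} {a} refl = α-cancelʳ v a

  α-commute : ∀ v w x → αo v (αo w x) ≡ αo w (αo v x)
  α-commute v w x = trans (α+-o v w x) (trans (αo-cong x (+ᶻ-comm v w)) (sym (α+-o w v x)))

  source-⊕ : ∀ {m p : Vec ℕ l} {a b c} → αo (negᶻ (ι m)) a ≡ b → αo (negᶻ (ι p)) b ≡ c →
             αo (negᶻ (ι (m ⊕ p))) a ≡ c
  source-⊕ {m} {p} {a} refl refl =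
    trans (αo-cong a (trans (cong negᶻ (ι-⊕ m p)) (trans (negᶻ-distrib (ι m) (ι p)) (+ᶻ-comm _ _))))
          (sym (α+-o (negᶻ (ι p)) (negᶻ (ι m)) a))

  -- Morphisms whose endpoints vary are compared in the total space Mor cat.
  MorΛ : Set
  MorΛ = Mor cat

  αh-cong : ∀ {v w : Vec ℤ l} {a b} (f : Hom a b) → v ≡ w →
            _≡_ {A = MorΛ} (αo v a , αo v b , αh v f) (αo w a , αo w b , αh w f)
  αh-cong f refl = refl

  αh-resp : ∀ (v : Vec ℤ l) {A B A' B'} {h : Hom A B} {h' : Hom A' B'} →
            _≡_ {A = MorΛ} (A , B , h) (A' , B' , h') →
            _≡_ {A = MorΛ} (αo v A , αo v B , αh v h) (αo v A' , αo v B' , αh v h')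
  αh-resp v refl = refl

  αh-id-over : ∀ (v : Vec ℤ l) {a b} → αo v b ≡ a →
               _≡_ {A = MorΛ} (αo v b , αo v b , αh v (idm b)) (a , a , idm a)
  αh-id-over v {b = b} refl = cong (λ h → αo v b , αo v b , h) (αh-id v b)

  αh-subst-src : ∀ (v : Vec ℤ l) {A A' B} (P : A ≡ A') (h : Hom A B) →
                 _≡_ {A = MorΛ} (αo v A' , αo v B , αh v (subst (λ t → Hom t B) P h))
                                (αo v A , αo v B , αh v h)
  αh-subst-src v refl h = refl

  α-cancel-mor : ∀ (v : Vec ℤ l) {A B} (f : Hom A B) →
                 _≡_ {A = MorΛ} (αo v (αo (negᶻ v) A) , αo v (αo (negᶻ v) B) , αh v (αh (negᶻ v) f))
                                (A , B , f)
  α-cancel-mor v f = trans (α+-h v (negᶻ v) f) (trans (αh-cong f (+ᶻ-neg v)) (α0-h f))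

  subst-tgt : ∀ {A B B'} (P : B ≡ B') (h : Hom A B) → _≡_ {A = MorΛ} (A , B' , subst (Hom A) P h) (A , B , h)
  subst-tgt refl h = refl

  subst-src : ∀ {A A' B} (P : A ≡ A') (h : Hom A B) →
              _≡_ {A = MorΛ} (A' , B , subst (λ t → Hom t B) P h) (A , B , h)
  subst-src refl h = refl

  ·-over : ∀ {x b A B c'} (f : Hom x b) (h : Hom A B) (g : Hom b c') →
           _≡_ {A = MorΛ} (A , B , h) (b , c' , g) → {P : A ≡ b} →
           _≡_ {A = Σ Obj (Hom x)} (B , f · subst (λ t → Hom t B) P h) (c' , f · g)
  ·-over f h g refl {refl} = refl

  -- A morphism (λ, m) of the crossed product is determined by m and λ:
  -- its last component is an equation between vertices, hence unique.
  Underlying : Obj → Set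
  Underlying x = Σ (Vec ℕ l) (λ _ → Σ Obj (Hom x))

  underlying : ∀ {x y} → HomX x y → Underlying x
  underlying (m , z , f , _) = m , z , f

  underlying-injective : ∀ {x y} {h h' : HomX x y} → underlying h ≡ underlying h' → h ≡ h'
  underlying-injective {h = m , z , f , p} {.m , .z , .f , p'} refl = cong (λ e → m , z , f , e) (uip p p')

  shift : ∀ (a b : Obj) (m : Vec ℕ l) → αo (negᶻ (ι m)) a ≡ b → HomX a b
  shift a b m e = m , a , idm a , e

  shift-cong : ∀ {a b} {m m' : Vec ℕ l} {e : αo (negᶻ (ι m)) a ≡ b} {e' : αo (negᶻ (ι m')) a ≡ b} →
               m ≡ m' → shift a b m e ≡ shift a b m' e'
  shift-cong refl = underlying-injective refl

  incl-shift : ∀ {x z y} (f : Hom x z) (m : Vec ℕ l) (e : αo (negᶻ (ι m)) z ≡ y) →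
               compX (incl f) (shift z y m e) ≡ (m , z , f , e)
  incl-shift {z = z} f m e = underlying-injective (cong₂ _,_ (⊕-identityˡ m)
    (trans (·-over f (αh (ι (0ᴺ l)) (idm z)) (idm z)
                   (αh-id-over (ι (0ᴺ l)) (trans (αo-cong z (ι-0 l)) (α0-o z))))
           (cong (z ,_) (idʳ f))))

  shift-shift : ∀ {a b c} (m n : Vec ℕ l) (e : αo (negᶻ (ι m)) a ≡ b) (e' : αo (negᶻ (ι n)) b ≡ c) →
                compX (shift a b m e) (shift b c n e') ≡ shift a c (m ⊕ n) (source-⊕ e e')
  shift-shift {a} {b} m n e e' = underlying-injective (cong (m ⊕ n ,_)
    (trans (·-over (idm a) (αh (ι m) (idm b)) (idm a) (αh-id-over (ι m) (α-transpose e)))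
           (cong (a ,_) (idˡ (idm a)))))

  shift-incl : ∀ {a b a' b'} (n : Vec ℕ l) (f : Hom a b) (f' : Hom a' b')
               (e₁ : αo (negᶻ (ι n)) a' ≡ a) (e₂ : αo (negᶻ (ι n)) b' ≡ b) →
               _≡_ {A = MorΛ} (αo (ι n) a , αo (ι n) b , αh (ι n) f) (a' , b' , f') →
               compX (shift a' a n e₁) (incl f) ≡ compX (incl f') (shift b' b n e₂)
  shift-incl {a} {b} {a'} {b'} n f f' e₁ e₂ M = trans
    (underlying-injective (cong₂ _,_ (⊕-identityʳ n)
      (trans (·-over (idm a') (αh (ι n) f) f' M) (cong (b' ,_) (idˡ f')))))
    (sym (incl-shift f' n e₂))

  incl-· : ∀ {a b c} (f : Hom a b) (g : Hom b c) → compX (incl f) (incl g) ≡ incl (f · g)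
  incl-· f g = underlying-injective (cong₂ _,_ (⊕-identityˡ (0ᴺ l))
    (·-over f (αh (ι (0ᴺ l)) g) g (trans (αh-cong g (ι-0 l)) (α0-h g))))

  deg : ∀ {x y} → WordD x y → Vec ℤ l
  deg [] = 0ᶻ l
  deg ((m , _) ∷⁺ w) = ι m +ᶻ deg w
  deg ((m , _) ∷⁻ w) = negᶻ (ι m) +ᶻ deg w

  deg-++ : ∀ {x y z} (a : WordD x y) (b : WordD y z) → deg (a ++D b) ≡ deg a +ᶻ deg b
  deg-++ [] b = sym (+ᶻ-identityˡ _)
  deg-++ ((m , _) ∷⁺ a) b = trans (cong (ι m +ᶻ_) (deg-++ a b)) (sym (+ᶻ-assoc _ _ _))
  deg-++ ((m , _) ∷⁻ a) b = trans (cong (negᶻ (ι m) +ᶻ_) (deg-++ a b)) (sym (+ᶻ-assoc _ _ _))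

  deg-resp : ∀ {x y} {v w : WordD x y} → v ≈D w → deg v ≡ deg w
  deg-resp ≈-refl = refl
  deg-resp (≈-sym r) = sym (deg-resp r)
  deg-resp (≈-trans r s) = trans (deg-resp r) (deg-resp s)
  deg-resp (cong⁺ (m , _) r) = cong (ι m +ᶻ_) (deg-resp r)
  deg-resp (cong⁻ (m , _) r) = cong (negᶻ (ι m) +ᶻ_) (deg-resp r)
  deg-resp (comp (m , _) (n , _) w) = trans (sym (+ᶻ-assoc _ _ _)) (cong (_+ᶻ deg w) (sym (ι-⊕ m n)))
  deg-resp (unit w) = trans (cong (_+ᶻ deg w) (ι-0 l)) (+ᶻ-identityˡ _)
  deg-resp (invʳ (m , _) w) = +ᶻ-cancel-+−ˡ (ι m) (deg w)
  deg-resp (invˡ (m , _) w) = +ᶻ-cancel-−+ˡ (ι m) (deg w)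

  I : ∀ {x y} → WordΛ x y → WordD x y
  I = i* Λ α

  deg-i* : ∀ {x y} (c : WordΛ x y) → deg (I c) ≡ 0ᶻ l
  deg-i* [] = refl
  deg-i* (f ∷⁺ c) = trans (cong₂ _+ᶻ_ (ι-0 l) (deg-i* c)) (+ᶻ-identityˡ _)
  deg-i* (f ∷⁻ c) = trans (cong₂ _+ᶻ_ (neg-ι-0 l) (deg-i* c)) (+ᶻ-identityˡ _)

  i*-resp : ∀ {x y} {a b : WordΛ x y} → a ≈Λ b → I a ≈D I b
  i*-resp ≈-refl = ≈-refl
  i*-resp (≈-sym r) = ≈-sym (i*-resp r)
  i*-resp (≈-trans r s) = ≈-trans (i*-resp r) (i*-resp s)
  i*-resp (cong⁺ f r) = cong⁺ (incl f) (i*-resp r)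
  i*-resp (cong⁻ f r) = cong⁻ (incl f) (i*-resp r)
  i*-resp (comp f g w) = ≈-trans (comp (incl f) (incl g) (I w)) (WD.≡⇒≈ (cong (_∷⁺ I w) (incl-· f g)))
  i*-resp (unit w) = unit (I w)
  i*-resp (invʳ f w) = invʳ (incl f) (I w)
  i*-resp (invˡ f w) = invˡ (incl f) (I w)

  i*-++ : ∀ {x y z} (a : WordΛ x y) (b : WordΛ y z) → I (Groupoid._++_ cat a b) ≈D (I a ++D I b)
  i*-++ a b = WD.≡⇒≈ (mapWord-++ a b)
    where
      mapWord-++ : ∀ {x y z} (a : WordΛ x y) (b : WordΛ y z) → I (Groupoid._++_ cat a b) ≡ I a ++D I b
      mapWord-++ [] b = refl
      mapWord-++ (f ∷⁺ a) b = cong (incl f ∷⁺_) (mapWord-++ a b)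
      mapWord-++ (f ∷⁻ a) b = cong (incl f ∷⁻_) (mapWord-++ a b)

  -- Injectivity of (i_Λ)_*.  unwind a w reads w starting at index a ∈ ℤ^l,
  -- sending a letter (λ, m) to α_a(λ) and moving on to index a ± ι m.
  unwind-src⁺ : ∀ (a : Vec ℤ l) (m : Vec ℕ l) z {y'} → αo (negᶻ (ι m)) z ≡ y' →
                αo (a +ᶻ ι m) y' ≡ αo a z
  unwind-src⁺ a m z refl = trans (α+-o (a +ᶻ ι m) (negᶻ (ι m)) z) (αo-cong z (+ᶻ-cancel-+- a (ι m)))

  unwind-src⁻ : ∀ (a : Vec ℤ l) (m : Vec ℕ l) z {x} → αo (negᶻ (ι m)) z ≡ x →
                αo (a +ᶻ negᶻ (ι m)) z ≡ αo a x
  unwind-src⁻ a m z refl = sym (α+-o a (negᶻ (ι m)) z)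

  unwind : ∀ {x y} (a : Vec ℤ l) (w : WordD x y) → WordΛ (αo a x) (αo (a +ᶻ deg w) y)
  unwind {x} a [] = castW refl (αo-cong x (sym (+ᶻ-identityʳ a))) []
  unwind {y = y} a ((m , z , f , p) ∷⁺ w) =
    αh a f ∷⁺ castW (unwind-src⁺ a m z p) (αo-cong y (+ᶻ-assoc a (ι m) (deg w))) (unwind (a +ᶻ ι m) w)
  unwind {y = y} a ((m , z , f , p) ∷⁻ w) =
    castW (unwind-src⁻ a m z p) refl
      (αh (a +ᶻ negᶻ (ι m)) f ∷⁻
         castW refl (αo-cong y (+ᶻ-assoc a (negᶻ (ι m)) (deg w))) (unwind (a +ᶻ negᶻ (ι m)) w))

  unwind-index : ∀ {x y} (w : WordD x y) {a a'} → a ≡ a' → unwind a w ≅ unwind a' w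
  unwind-index w = ≅-index (λ a → unwind a w)

  unwind-comp : ∀ a {x z z' y} (f : HomX x z) (g : HomX z z') (w : WordD z' y) →
                unwind a (f ∷⁺ g ∷⁺ w) ≅ unwind a (compX f g ∷⁺ w)
  unwind-comp a (m , z , f , p) (n , _ , μ , _) w =
    ≅-trans (≅-cons⁺ refl (≅-trans (cast-≅ _ _ _)
              (≅-cons⁺ (sym (trans (αh-subst-src a _ (αh (ι m) μ)) (α+-h a (ι m) μ)))
                (≅-trans (cast-≅ _ _ _)
                  (≅-trans (unwind-index w (trans (+ᶻ-assoc a (ι m) (ι n)) (cong (a +ᶻ_) (sym (ι-⊕ m n)))))
                           (≅-sym (cast-≅ _ _ _)))))))
      (≅-sym (≈⇒≅ αh-split))
    where
      αh-split : ∀ {A B C' Y} {f : Hom A B} {g : Hom B C'} {r : WordΛ (αo a C') Y} →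
                 (αh a (f · g) ∷⁺ r) ≈Λ (αh a f ∷⁺ αh a g ∷⁺ r)
      αh-split {f = f} {g} {r} = WΛ.split⁺ r (αh-· a f g)

  unwind-unit : ∀ a {x y} (w : WordD x y) → unwind a (idX x ∷⁺ w) ≅ unwind a w
  unwind-unit a {x} w =
    ≅-trans (≈⇒≅ (αh-unit _))
      (≅-trans (cast-≅ _ _ _) (unwind-index w (trans (cong (a +ᶻ_) (ι-0 l)) (+ᶻ-identityʳ a))))
    where
      αh-unit : ∀ {Y} (r : WordΛ (αo a x) Y) → (αh a (idm x) ∷⁺ r) ≈Λ r
      αh-unit r = ≈-trans (WΛ.≡⇒≈ (cong (_∷⁺ r) (αh-id a x))) (unit r)

  unwind-invʳ : ∀ a {x z y} (f : HomX x z) (w : WordD x y) → unwind a (f ∷⁺ f ∷⁻ w) ≅ unwind a w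
  unwind-invʳ a {y = y} (m , z , f , p) w =
    ≅-trans (≅-invʳ (αh-cong f (sym (+ᶻ-cancel-+- a (ι m))))
      (≅-trans (cast-≅ (unwind-src⁺ a m z p) (αo-cong y (+ᶻ-assoc a (ι m) (deg ((m , z , f , p) ∷⁻ w)))) _)
               (cast-≅ (unwind-src⁻ (a +ᶻ ι m) m z p) refl _)))
      (≅-trans (cast-≅ _ _ _) (unwind-index w (+ᶻ-cancel-+- a (ι m))))

  unwind-invˡ : ∀ a {x z y} (f : HomX z x) (w : WordD x y) → unwind a (f ∷⁻ f ∷⁺ w) ≅ unwind a w
  unwind-invˡ a (m , z , f , p) w =
    ≅-trans (cast-≅ _ _ _) (≅-trans (≅-invˡ refl (cast-≅ _ _ _))
      (≅-trans (cast-≅ _ _ _) (unwind-index w (+ᶻ-cancel-−+ a (ι m)))))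

  unwind-resp : ∀ {x y} {v w : WordD x y} → v ≈D w → ∀ a → unwind a v ≅ unwind a w
  unwind-resp ≈-refl a = ≅-refl
  unwind-resp (≈-sym r) a = ≅-sym (unwind-resp r a)
  unwind-resp (≈-trans r s) a = ≅-trans (unwind-resp r a) (unwind-resp s a)
  unwind-resp (cong⁺ (m , z , f , p) r) a =
    ≅-cons⁺ refl (≅-trans (cast-≅ _ _ _) (≅-trans (unwind-resp r _) (≅-sym (cast-≅ _ _ _))))
  unwind-resp (cong⁻ (m , z , f , p) r) a =
    ≅-trans (cast-≅ _ _ _) (≅-trans (≅-cons⁻ refl
      (≅-trans (cast-≅ _ _ _) (≅-trans (unwind-resp r _) (≅-sym (cast-≅ _ _ _))))) (≅-sym (cast-≅ _ _ _)))
  unwind-resp (comp f g w) a = unwind-comp a f g w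
  unwind-resp (unit w) a = unwind-unit a w
  unwind-resp (invʳ f w) a = unwind-invʳ a f w
  unwind-resp (invˡ f w) a = unwind-invˡ a f w

  αW : ∀ {x y} (a : Vec ℤ l) → WordΛ x y → WordΛ (αo a x) (αo a y)
  αW a = mapWord cat cat (αo a) (αh a)

  αW-zero : ∀ {x y} (c : WordΛ x y) → αW (0ᶻ l) c ≅ c
  αW-zero {x} [] = ≅-index {s = λ t → t} (λ t → []) (α0-o x)
  αW-zero (f ∷⁺ c) = ≅-cons⁺ (α0-h f) (αW-zero c)
  αW-zero (f ∷⁻ c) = ≅-cons⁻ (α0-h f) (αW-zero c)

  unwind-i* : ∀ {x y} (a : Vec ℤ l) (c : WordΛ x y) → unwind a (I c) ≅ αW a c
  unwind-i* a [] = cast-≅ _ _ _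
  unwind-i* a (f ∷⁺ c) =
    ≅-cons⁺ refl (≅-trans (cast-≅ _ _ _) (≅-trans (unwind-i* _ c) (≅-index (λ b → αW b c) a+ι0)))
    where
      a+ι0 : a +ᶻ ι (0ᴺ l) ≡ a
      a+ι0 = trans (cong (a +ᶻ_) (ι-0 l)) (+ᶻ-identityʳ a)
  unwind-i* a (f ∷⁻ c) = ≅-trans (cast-≅ _ _ _)
    (≅-cons⁻ (αh-cong f a−ι0)
      (≅-trans (cast-≅ _ _ _) (≅-trans (unwind-i* _ c) (≅-index (λ b → αW b c) a−ι0))))
    where
      a−ι0 : a +ᶻ negᶻ (ι (0ᴺ l)) ≡ a
      a−ι0 = trans (cong (a +ᶻ_) (neg-ι-0 l)) (+ᶻ-identityʳ a)

  -- unwind 0 is a left inverse of (i_Λ)_*, which is therefore injective.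
  i*-injective : ∀ {x y} (a b : WordΛ x y) → I a ≈D I b → a ≈Λ b
  i*-injective a b r = WΛ.≅⇒≈
    (≅-trans (≅-sym (αW-zero a)) (≅-trans (≅-sym (unwind-i* (0ᶻ l) a))
    (≅-trans (unwind-resp r (0ᶻ l)) (≅-trans (unwind-i* (0ᶻ l) b) (αW-zero b)))))

  record NormalForm {x y : Obj} (w : WordD x y) : Set where
    constructor normalForm
    field
      X T : Obj
      n p : Vec ℕ l
      e₁ : αo (negᶻ (ι n)) X ≡ x
      e₂ : αo (negᶻ (ι p)) X ≡ T
      c : WordΛ T y
      eq : w ≈D (shift X x n e₁ ∷⁻ shift X T p e₂ ∷⁺ I c)

  shift-zero : ∀ x → αo (negᶻ (ι (0ᴺ l))) x ≡ x
  shift-zero x = trans (αo-cong x (neg-ι-0 l)) (α0-o x)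

  normalForm-[] : ∀ {x} → NormalForm ([] {x = x})
  normalForm-[] {x} = normalForm x x (0ᴺ l) (0ᴺ l) (shift-zero x) (shift-zero x) []
                        (≈-sym (invˡ (shift x x (0ᴺ l) (shift-zero x)) []))

  -- A letter (λ, m) is absorbed by pushing the shift_m it contains to the
  -- right of shift_n⁻¹ and then pushing λ to the right of both shifts.
  normalForm-∷⁺ : ∀ {x y₀ y} (L : HomX x y₀) {w : WordD y₀ y} → NormalForm w → NormalForm (L ∷⁺ w)
  normalForm-∷⁺ {x} {y₀} (m , z , λ' , p₀) {w} (normalForm X T n p e₁ e₂ c eq) =
    normalForm Xn Y n (m ⊕ p) e₄ refl (λ₂ ∷⁺ c) (begin
      L ∷⁺ w
        ≈⟨ cong⁺ L eq ⟩
      L ∷⁺ sn ∷⁻ sp ∷⁺ I c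
        ≈⟨ WD.split⁺ _ (sym (incl-shift λ' m p₀)) ⟩
      incl λ' ∷⁺ sm ∷⁺ sn ∷⁻ sp ∷⁺ I c
        ≈⟨ cong⁺ (incl λ') (WD.square-turnʳ _ shifts-commute) ⟩
      incl λ' ∷⁺ s₁ ∷⁻ s₂ ∷⁺ sp ∷⁺ I c
        ≈⟨ cong⁺ (incl λ') (cong⁻ s₁ (WD.split⁺ _ (sym (shift-shift m p ex e₂)))) ⟨
      incl λ' ∷⁺ s₁ ∷⁻ smp ∷⁺ I c
        ≈⟨ WD.square-turnʳ _ (shift-incl n λ' λ₁ e₄ ez refl) ⟩
      s₃ ∷⁻ incl λ₁ ∷⁺ smp ∷⁺ I c
        ≈⟨ cong⁻ s₃ (WD.square⁺ _ (sym λ₁-past-smp)) ⟩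
      s₃ ∷⁻ s₄ ∷⁺ incl λ₂ ∷⁺ I c ∎)
    where
      open WD.≈-Reasoning
      L : HomX x y₀
      L = (m , z , λ' , p₀)
      z' : Obj
      z' = αo (ι n) z
      ez : αo (negᶻ (ι n)) z' ≡ z
      ez = α-cancelˡ (ι n) z
      ex : αo (negᶻ (ι m)) z' ≡ X
      ex = trans (α-commute (negᶻ (ι m)) (ι n) z) (trans (cong (αo (ι n)) p₀) (α-transpose e₁))
      e₃ : αo (negᶻ (ι (m ⊕ p))) z' ≡ T
      e₃ = source-⊕ ex e₂
      Xn : Obj
      Xn = αo (ι n) x
      e₄ : αo (negᶻ (ι n)) Xn ≡ x
      e₄ = α-cancelˡ (ι n) x
      λ₁ : Hom Xn z'
      λ₁ = αh (ι n) λ'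
      Y : Obj
      Y = αo (negᶻ (ι (m ⊕ p))) Xn
      λ₂ : Hom Y T
      λ₂ = subst (Hom Y) e₃ (αh (negᶻ (ι (m ⊕ p))) λ₁)
      sm : HomX z y₀
      sm = shift z y₀ m p₀
      sn : HomX X y₀
      sn = shift X y₀ n e₁
      sp : HomX X T
      sp = shift X T p e₂
      s₁ : HomX z' z
      s₁ = shift z' z n ez
      s₂ : HomX z' X
      s₂ = shift z' X m ex
      smp : HomX z' T
      smp = shift z' T (m ⊕ p) e₃
      s₃ : HomX Xn x
      s₃ = shift Xn x n e₄
      s₄ : HomX Xn Y
      s₄ = shift Xn Y (m ⊕ p) refl
      shifts-commute : compX s₁ sm ≡ compX s₂ sn
      shifts-commute =
        trans (shift-shift n m ez p₀) (trans (shift-cong (⊕-comm n m)) (sym (shift-shift m n ex e₁)))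
      λ₁-past-smp : compX s₄ (incl λ₂) ≡ compX (incl λ₁) smp
      λ₁-past-smp = shift-incl (m ⊕ p) λ₂ λ₁ refl e₃
        (trans (αh-resp (ι (m ⊕ p)) (subst-tgt e₃ (αh (negᶻ (ι (m ⊕ p))) λ₁)))
               (α-cancel-mor (ι (m ⊕ p)) λ₁))

  -- An inverse letter (λ, m)⁻¹ is absorbed symmetrically: λ⁻¹ is pushed to
  -- the right past shift_n⁻¹ and shift_p, and shift_m⁻¹ joins shift_n⁻¹.
  normalForm-∷⁻ : ∀ {x y₀ y} (L : HomX y₀ x) {w : WordD y₀ y} → NormalForm w → NormalForm (L ∷⁻ w)
  normalForm-∷⁻ {x} {y₀} (m , z , λ' , p₀) {w} (normalForm X T n p e₁ e₂ c eq) =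
    normalForm z' Y (n ⊕ m) p (source-⊕ ez p₀) refl (g ∷⁻ c) (begin
      L ∷⁻ w
        ≈⟨ cong⁻ L eq ⟩
      L ∷⁻ sn ∷⁻ sp ∷⁺ I c
        ≈⟨ WD.split⁻ _ (sym (incl-shift λ' m p₀)) ⟩
      sm ∷⁻ incl λ' ∷⁻ sn ∷⁻ sp ∷⁺ I c
        ≈⟨ cong⁻ sm (WD.square⁻ _ λ'-past-sn) ⟩
      sm ∷⁻ s₁ ∷⁻ incl f' ∷⁻ sp ∷⁺ I c
        ≈⟨ cong⁻ sm (cong⁻ s₁ (WD.square-turnˡ _ g-past-sp)) ⟩
      sm ∷⁻ s₁ ∷⁻ s₅ ∷⁺ incl g ∷⁻ I c                           ≈⟨ WD.inverse-· _ ⟩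
      compX s₁ sm ∷⁻ s₅ ∷⁺ incl g ∷⁻ I c
        ≡⟨ cong (_∷⁻ s₅ ∷⁺ incl g ∷⁻ I c) (shift-shift n m ez p₀) ⟩
      shift z' x (n ⊕ m) (source-⊕ ez p₀) ∷⁻ s₅ ∷⁺ incl g ∷⁻ I c ∎)
    where
      open WD.≈-Reasoning
      L : HomX y₀ x
      L = (m , z , λ' , p₀)
      z' : Obj
      z' = αo (ι n) z
      ez : αo (negᶻ (ι n)) z' ≡ z
      ez = α-cancelˡ (ι n) z
      f' : Hom X z'
      f' = subst (λ t → Hom t z') (α-transpose e₁) (αh (ι n) λ')
      Y : Obj
      Y = αo (negᶻ (ι p)) z'
      g : Hom T Y
      g = subst (λ t → Hom t Y) e₂ (αh (negᶻ (ι p)) f')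
      sm : HomX z x
      sm = shift z x m p₀
      sn : HomX X y₀
      sn = shift X y₀ n e₁
      sp : HomX X T
      sp = shift X T p e₂
      s₁ : HomX z' z
      s₁ = shift z' z n ez
      s₅ : HomX z' Y
      s₅ = shift z' Y p refl
      λ'-past-sn : compX sn (incl λ') ≡ compX (incl f') s₁
      λ'-past-sn = shift-incl n λ' f' e₁ ez (sym (subst-src (α-transpose e₁) (αh (ι n) λ')))
      g-past-sp : compX sp (incl g) ≡ compX (incl f') s₅
      g-past-sp = shift-incl p g f' e₂ refl
        (trans (αh-resp (ι p) (subst-src e₂ (αh (negᶻ (ι p)) f'))) (α-cancel-mor (ι p) f'))

  normalize : ∀ {x y} (w : WordD x y) → NormalForm w
  normalize []       = normalForm-[]
  normalize (L ∷⁺ w) = normalForm-∷⁺ L (normalize w)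
  normalize (L ∷⁻ w) = normalForm-∷⁻ L (normalize w)

  collapse : ∀ {u X T : Obj} {n p : Vec ℕ l} (e₁ : αo (negᶻ (ι n)) X ≡ u) (e₂ : αo (negᶻ (ι p)) X ≡ T)
             (c : WordΛ T u) → p ≡ n → T ≡ u →
             Σ[ a ∈ WordΛ u u ] (I a ≈D (shift X u n e₁ ∷⁻ shift X T p e₂ ∷⁺ I c))
  collapse e₁ e₂ c refl refl rewrite uip e₂ e₁ = c , ≈-sym (invˡ _ _)

  kernel⊆image : ∀ {u} (b : WordD u u) → deg b ≡ 0ᶻ l → Σ[ a ∈ WordΛ u u ] (I a ≈D b)
  kernel⊆image {u} b deg-b with normalize b
  ... | normalForm X T n p e₁ e₂ c eq =
    proj₁ collapsed , ≈-trans (proj₂ collapsed) (≈-sym eq)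
    where
      deg-nf : negᶻ (ι n) +ᶻ (ι p +ᶻ 0ᶻ l) ≡ 0ᶻ l
      deg-nf = trans (cong (λ v → negᶻ (ι n) +ᶻ (ι p +ᶻ v)) (sym (deg-i* c)))
                     (trans (sym (deg-resp eq)) deg-b)
      p≡n : p ≡ n
      p≡n = ι-injective (trans (sym (+ᶻ-identityʳ (ι p))) (+ᶻ-inverse-unique (ι n) _ deg-nf))
      collapsed : Σ[ a ∈ WordΛ u u ] (I a ≈D (shift X u n e₁ ∷⁻ shift X T p e₂ ∷⁺ I c))
      collapsed = collapse e₁ e₂ c p≡n (trans (sym e₂) (trans (cong (λ v → αo (negᶻ (ι v)) X) p≡n) e₁))

  image⊆kernel : ∀ {u} (b : WordD u u) → Σ[ a ∈ WordΛ u u ] (I a ≈D b) → deg b ≡ 0ᶻ l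
  image⊆kernel b (a , r) = trans (sym (deg-resp r)) (deg-i* a)

  -- deg is onto when Λ is connected: ι P − ι N is the degree of the loop
  -- shift_P · (a path of Λ) · shift_N⁻¹.
  deg-surjective : Groupoid.Connected cat → ∀ u (z : Vec ℤ l) → Σ[ b ∈ WordD u u ] deg b ≡ z
  deg-surjective connected u z with ℤ^-difference z
  ... | P , N , P−N≡z = b , deg-b
    where
      t t' : Obj
      t = αo (negᶻ (ι P)) u
      t' = αo (negᶻ (ι N)) u
      path : WordD t t'
      path = I (connected t t')
      b : WordD u u
      b = shift u t P refl ∷⁺ (path ++D (shift u t' N refl ∷⁻ []))
      deg-b : deg b ≡ z
      deg-b = begin
        ι P +ᶻ deg (path ++D (shift u t' N refl ∷⁻ []))
          ≡⟨ cong (ι P +ᶻ_) (deg-++ path _) ⟩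
        ι P +ᶻ (deg path +ᶻ (negᶻ (ι N) +ᶻ 0ᶻ l))
          ≡⟨ cong (λ v → ι P +ᶻ (v +ᶻ _)) (deg-i* (connected t t')) ⟩
        ι P +ᶻ (0ᶻ l +ᶻ (negᶻ (ι N) +ᶻ 0ᶻ l))           ≡⟨ cong (ι P +ᶻ_) (+ᶻ-identityˡ _) ⟩
        ι P +ᶻ (negᶻ (ι N) +ᶻ 0ᶻ l)                     ≡⟨ cong (ι P +ᶻ_) (+ᶻ-identityʳ _) ⟩
        ι P +ᶻ negᶻ (ι N)                               ≡⟨ P−N≡z ⟩
        z                                               ∎
        where open ≡-Reasoning

mainTheorem8 : ∀ {k l : ℕ} (Λ : KGraph k) (α : Action Λ l) →
    Groupoid.Connected (KGraph.cat Λ) →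
    (u : KGraph.Obj Λ) →
    Σ[ q ∈ (Groupoid.Word (Crossed.crossedCat Λ α) u u → Vec ℤ l) ]
    IsExtension (KGraph.cat Λ) (Crossed.crossedCat Λ α) u u l (i* Λ α) q
mainTheorem8 Λ α connected u =
  deg ,
  ( i*-resp , i*-++
  , deg-resp , deg-++
  , i*-injective
  , (λ b → mk⇔ (kernel⊆image b) (image⊆kernel b))
  , deg-surjective connected u )
  where open Extension Λ α
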